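{- Let $n$ be a positive integer, $A \subseteq \{1,\dots,n\}$, $L := \operatorname{lcm}(\widetilde{u}_a : a \in A)$ and $X := \log L$. Then \[ X = \sum_{\substack{m \geq 1,\ (m,c_2)=1 \\ \varrho(m) \leq n}} \Lambda(m)\, I_A(m). \]
   Context: Let $a_1,a_2$ be nonzero integers, $\alpha,\beta$ with $|\alpha|\geq|\beta|$ the roots of $X^2 - a_1X - a_2$, with $\alpha/\beta$ not a root of unity. Let $b := \gcd(a_1^2, a_2)$, $\zeta := \alpha/\sqrt{b}$, $\eta := \beta/\sqrt{b}$; then $c_1 := (\zeta+\eta)^2 = a_1^2/b$ and $c_2 := \zeta\eta = -a_2/b$ are nonzero coprime integers. The Lehmer sequence is $\widetilde{u}_k := (\zeta^k - \eta^k)/(\zeta - \eta)$ for odd $k$ and $\widetilde{u}_k := (\zeta^k - \eta^k)/(\zeta^2 - \eta^2)$ for even $k$ (integers). For $m \geq 1$ coprime with $c_2$, $\varrho(m)$ is the smallest positive integer $k$ with $m \mid \widetilde{u}_k$. For such $m$, $I_A(m) := 1$ if $\varrho(m) \mid a$ for some $a \in A$, and $I_A(m) := 0$ otherwise. $\Lambda$ is the von Mangoldt function; $\operatorname{lcm}(\varnothing) := 1$. -}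

module Defs where

open import Data.Nat as ℕ using (ℕ; zero; suc; _≤_; _^_)
open import Data.Nat.Divisibility using (_∣?_)
open import Data.Nat.Coprimality using (coprime?)
open import Data.Nat.Primality using (prime?)
open import Data.Nat.LCM using (lcm)
open import Data.Integer as ℤ using (ℤ; +_; ∣_∣)
open import Data.Bool using (Bool; true; false; if_then_else_)
open import Data.List using (List; []; _∷_; foldr; map; upTo)
open import Data.Bool.ListAction using (any)
open import Data.Nat.ListAction using (product)
open import Data.Maybe using (Maybe; just; nothing)
open import Relation.Nullary using (does)

odd : ℕ → Bool
odd zero    = false
odd (suc k) = if odd k then false else true

-- Lehmer sequence attached to (c1, c2) = ((ζ+η)², ζη):
--   ũ_0 = 0, ũ_1 = 1,
--   ũ_{k+2} = c1 ũ_{k+1} - c2 ũ_k   if k+2 is odd,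
--   ũ_{k+2} =    ũ_{k+1} - c2 ũ_k   if k+2 is even.
-- (This recurrence is equivalent to the closed form
--  (ζ^k - η^k)/(ζ - η) for odd k, (ζ^k - η^k)/(ζ² - η²) for even k.)
lehmer : ℤ → ℤ → ℕ → ℤ
lehmer c1 c2 zero = + 0
lehmer c1 c2 (suc zero) = + 1
lehmer c1 c2 (suc (suc k)) =
  (if odd k then c1 else + 1) ℤ.* lehmer c1 c2 (suc k) ℤ.- c2 ℤ.* lehmer c1 c2 k

firstDivIn : ℤ → ℤ → ℕ → List ℕ → Maybe ℕ
firstDivIn c1 c2 m [] = nothing
firstDivIn c1 c2 m (k ∷ ks) =
  if does (m ∣? ∣ lehmer c1 c2 k ∣) then just k else firstDivIn c1 c2 m ks

-- rankUpTo c1 c2 m n = just ϱ(m) if ϱ(m) ≤ n, nothing otherwise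
-- (search over k = 1, …, n in increasing order)
rankUpTo : ℤ → ℤ → ℕ → ℕ → Maybe ℕ
rankUpTo c1 c2 m n = firstDivIn c1 c2 m (map suc (upTo n))

-- I_A(m) for A ⊆ {1,…,n}: true iff ϱ(m) ∣ a for some a ∈ A.
-- (Since every a ∈ A satisfies 1 ≤ a ≤ n, ϱ(m) ∣ a forces ϱ(m) ≤ n.)
indicator : ℤ → ℤ → ℕ → List ℕ → ℕ → Bool
indicator c1 c2 n A m with rankUpTo c1 c2 m n
... | nothing = false
... | just r  = any (λ a → does (r ∣? a)) A

expΛ : ℕ → ℕ
expΛ m = go (upTo (suc m))
  where
  go : List ℕ → ℕ
  go [] = 1
  go (p ∷ ps) =
    if does (prime? p) then
      (if any (λ k → does (p ^ suc k ℕ.≟ m)) (upTo m) then p else go ps)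
    else go ps

-- exp of the summand Λ(m) I_A(m) restricted to (m, c2) = 1 (m ≥ 1)
weight : ℤ → ℤ → ℕ → List ℕ → ℕ → ℕ
weight c1 c2 n A m =
  if does (coprime? m ∣ c2 ∣) then
    (if indicator c1 c2 n A m then expΛ m else 1)
  else 1

partialProd : ℤ → ℤ → ℕ → List ℕ → ℕ → ℕ
partialProd c1 c2 n A M = product (map (weight c1 c2 n A) (map suc (upTo M)))

lcmList : List ℕ → ℕ
lcmList = foldr lcm 1

bOf : ℤ → ℤ → ℤ
bOf a1 a2 = + Data.Nat.GCD.gcd ∣ a1 ℤ.* a1 ∣ ∣ a2 ∣
  where import Data.Nat.GCD

-- A positive integer L is recovered from its prime-power divisors:
-- ∏_{d ≤ M} exp(Λ(d) [d ∣ L]) = L as soon as M ≥ L, i.e. log L = Σ_{d ∣ L} Λ(d).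
-- So it suffices to show that, for a prime power q, the summand Λ(q) I_A(q) [(q, c2) = 1]
-- equals Λ(q) [q ∣ L], and a prime power divides an lcm iff it divides one of its
-- arguments. Every ũ_a (a ≥ 1) is coprime to c2, so a prime power sharing a prime with
-- c2 divides no ũ_a. For q coprime to c2, the addition formula
-- ũ_{r+k+1} = α ũ_{r+1} ũ_{k+1} - c2 β ũ_r ũ_k (α, β ∈ {1, c1}) together with the
-- Casoratian identity (whose value is c2^r) shows that q ∣ ũ_r and q ∣ ũ_{r+k} force
-- q ∣ ũ_k; hence q ∣ ũ_a iff ϱ(q) ∣ a, which is exactly I_A(q) = [q ∣ L].

module Submission where

open import Defs
open import Data.Nat using (ℕ; _≤_)
open import Data.Integer using (ℤ; +_; _+_; _*_; -_; ∣_∣)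
open import Data.List using (List; map)
open import Data.List.Relation.Unary.All using (All)
open import Data.Product using (_×_; ∃-syntax)
open import Relation.Binary.PropositionalEquality using (_≡_; _≢_)

open import Data.Bool using (Bool; true; false; T; if_then_else_; _xor_)
open import Data.Bool.ListAction using (any)
open import Data.Empty using (⊥-elim)
open import Data.Integer using (_-_)
import Data.Integer as ℤ
import Data.Integer.Coprimality as ℤCoprime
import Data.Integer.Divisibility as ℤ∣ᵤ
open import Data.Integer.Divisibility.Signed
  using (∣ᵤ⇒∣; ∣⇒∣ᵤ; ∣m∣n⇒∣m-n; ∣m+n∣n⇒∣m; ∣m⇒∣-m)
  renaming (_∣_ to _∣ℤ_; ∣m⇒∣m*n to ∣m⇒∣m*nℤ; ∣n⇒∣m*n to ∣n⇒∣m*nℤ)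
open import Data.Integer.Properties using (abs-*; ∣-i∣≡∣i∣; ∣i∣≡0⇒i≡0; i*j≡0⇒i≡0∨j≡0)
open import Data.Integer.Tactic.RingSolver renaming (solve-∀ to ℤ-solve-∀)
open import Data.List using ([]; _∷_; [_]; _++_; _∷ʳ_; upTo; applyUpTo)
open import Data.List.Membership.Propositional using (_∈_)
open import Data.List.Membership.Propositional.Properties using (∈-upTo⁺)
open import Data.List.Properties using (map-++; upTo-∷ʳ)
open import Data.List.Relation.Unary.All using ([]; _∷_; lookupAny)
import Data.List.Relation.Unary.All as All
import Data.List.Relation.Unary.All.Properties as Allₚ
open import Data.List.Relation.Unary.Any using (Any; here; there)
import Data.List.Relation.Unary.Any as Any
import Data.List.Relation.Unary.Any.Properties as Anyₚ
open import Data.Maybe using (Maybe; just; nothing; _<∣>_)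
open import Data.Nat
  using (zero; suc; _<_; _≟_; _≤?_; _^_; NonZero; z≤n; z<s; s<s; s≤s;
         nonTrivial⇒n>1; >-nonZero; ≢-nonZero)
  renaming (_+_ to _+ℕ_; _*_ to _*ℕ_)
open import Data.Nat.Coprimality
  using (Coprime; coprime?; coprime-divisor; coprime-/gcd; 1-coprimeTo)
  renaming (sym to Coprime-sym)
open import Data.Nat.Divisibility
  using (_∣_; _∣?_; divides; ∣-refl; ∣-trans; ∣1⇒≡1; _∣0; 1∣_; m∣m*n; n∣m*n; ∣m⇒∣m*n; ∣n⇒∣m*n;
         *-pres-∣; *-monoʳ-∣; *-cancelˡ-∣; quotient-<; ∣⇒≤; m%n≡0⇒n∣m)
open import Data.Nat.DivMod using (_/_; _%_; m*n/n≡m; m≡m%n+[m/n]*n; m%n<n)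
open import Data.Nat.GCD using (gcd; gcd[m,n]≢0)
open import Data.Nat.Induction using (<-rec)
open import Data.Nat.LCM using (lcm; gcd*lcm; lcm-comm; lcm-least; m∣lcm[m,n]; n∣lcm[m,n])
open import Data.Nat.ListAction using (product)
open import Data.Nat.ListAction.Properties using (product-++)
open import Data.Nat.Primality
  using (Prime; prime?; euclidsLemma; prime⇒irreducible; prime⇒nonZero; prime⇒nonTrivial;
         ¬prime[1]; productOfPrimes≢0)
open import Data.Nat.Primality.Factorisation using (factorise)
open import Data.Nat.Properties
  using (+-comm; +-identityʳ; *-comm; *-assoc; *-identityˡ; *-identityʳ; ^-distribˡ-+-*; ^-monoʳ-<;
         m^n≢0; m^n>0; m*n≢0; m*n≢0⇒m≢0; m*n≢0⇒n≢0; m≤m*n; m≤n*m; n≢0⇒n>0;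
         ≤-refl; ≤-trans; ≤-total; ≤-pred; ≤-<-trans; <-trans; <-asym; <-cmp; n<1+n; n≮n;
         ≰⇒>; <⇒≢; >⇒≢; <⇒≱; m≤n⇒m≤1+n; m≤n⇒m<n∨m≡n; m≤n⇒∃[o]m+o≡n)
open import Data.Nat.Tactic.RingSolver using (solve-∀)
open import Data.Product using (_,_; proj₁; proj₂)
open import Data.Sum using (_⊎_; inj₁; inj₂; [_,_]′)
open import Function using (id; _∘_; _⇔_; mk⇔; Equivalence)
open import Relation.Binary.Definitions using (Tri; tri<; tri≈; tri>)
open import Relation.Binary.PropositionalEquality
  using (refl; sym; trans; cong; cong₂; subst; subst₂; _≗_; module ≡-Reasoning)
open import Relation.Nullary using (¬_; Dec; yes; no; does; proof; contradiction)
open import Relation.Nullary.Decidable using (dec-true; dec-false; does-⇔)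
open import Relation.Nullary.Reflects using (det; fromEquivalence)
open import Relation.Unary using (Decidable)

private
  variable
    d j k m n p q v y : ℕ
    A : List ℕ

Coprime-∣ˡ : d ∣ m → Coprime m n → Coprime d n
Coprime-∣ˡ d∣m m⊥n (e∣d , e∣n) = m⊥n (∣-trans e∣d d∣m , e∣n)

Coprime-∣ʳ : d ∣ n → Coprime m n → Coprime m d
Coprime-∣ʳ d∣n m⊥n = Coprime-sym (Coprime-∣ˡ d∣n (Coprime-sym m⊥n))

coprime-cofactors : ∀ {m n x y} → .{{_ : NonZero (gcd m n)}} →
  gcd m n *ℕ x ≡ m → gcd m n *ℕ y ≡ n → Coprime x y
coprime-cofactors {m} {n} g*x≡m g*y≡n =
  subst₂ Coprime (cofactor≡ g*x≡m) (cofactor≡ g*y≡n) (coprime-/gcd m n)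
  where
  cofactor≡ : ∀ {z w} → gcd m n *ℕ z ≡ w → w / gcd m n ≡ z
  cofactor≡ {z} refl = trans (cong (_/ gcd m n) (*-comm (gcd m n) z)) (m*n/n≡m z (gcd m n))

coprime∧∣^⇒≡1 : ∀ {c : ℤ} r → Coprime d ∣ c ∣ → d ∣ ∣ c ℤ.^ r ∣ → d ≡ 1
coprime∧∣^⇒≡1 zero _ d∣1 = ∣1⇒≡1 d∣1
coprime∧∣^⇒≡1 {d} {c} (suc r) d⊥c d∣c^[1+r] =
  coprime∧∣^⇒≡1 r d⊥c (ℤCoprime.coprime-divisor (+ d) c (c ℤ.^ r) d⊥c d∣c^[1+r])

prime∤⇒coprime : Prime p → ¬ p ∣ n → Coprime p n
prime∤⇒coprime pp p∤n (d∣p , d∣n) with prime⇒irreducible pp d∣p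
... | inj₁ d≡1 = d≡1
... | inj₂ refl = contradiction d∣n p∤n

prime∣^⇒∣ : Prime p → p ∣ q ^ k → p ∣ q
prime∣^⇒∣ {k = zero} pp p∣1 = contradiction (subst Prime (∣1⇒≡1 p∣1) pp) ¬prime[1]
prime∣^⇒∣ {q = q} {k = suc k} pp p∣q^[1+k] =
  [ id , prime∣^⇒∣ {k = k} pp ]′ (euclidsLemma q (q ^ k) pp p∣q^[1+k])

prime∣prime⇒≡ : Prime p → Prime q → p ∣ q → p ≡ q
prime∣prime⇒≡ pp pq p∣q with prime⇒irreducible pq p∣q
... | inj₁ refl = contradiction pp ¬prime[1]
... | inj₂ p≡q = p≡q

prime^≡prime^⇒≡ : Prime p → Prime q → p ^ suc j ≡ q ^ suc k → p ≡ q
prime^≡prime^⇒≡ {p} {j = j} {k = k} pp pq eq =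
  prime∣prime⇒≡ pp pq (prime∣^⇒∣ {k = suc k} pp (subst (p ∣_) eq (m∣m*n (p ^ j))))

^-monoʳ-∣ : ∀ p → m ≤ n → p ^ m ∣ p ^ n
^-monoʳ-∣ {m} p m≤n with o , refl ← m≤n⇒∃[o]m+o≡n m≤n =
  subst (p ^ m ∣_) (sym (^-distribˡ-+-* p m o)) (m∣m*n (p ^ o))

n<m^n : 1 < m → n < m ^ n
n<m^n {n = zero} _ = z<s
n<m^n {m} {suc n} 1<m = ≤-<-trans (n<m^n 1<m) (^-monoʳ-< m 1<m (n<1+n n))

record PowerSplit (p x : ℕ) : Set where
  field
    exponent cofactor : ℕ
    split : x ≡ p ^ exponent *ℕ cofactor
    p∤cofactor : ¬ p ∣ cofactor

powerSplit : Prime p → ∀ x → .{{NonZero x}} → PowerSplit p x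
powerSplit {p} pp = <-rec (λ x → .{{NonZero x}} → PowerSplit p x) step
  where
  instance _ = prime⇒nonTrivial pp
  step : ∀ x → (∀ {y} → y < x → .{{NonZero y}} → PowerSplit p y) → .{{NonZero x}} → PowerSplit p x
  step x rec with p ∣? x
  ... | no p∤x = record { exponent = 0 ; cofactor = x ; split = sym (+-identityʳ x) ; p∤cofactor = p∤x }
  ... | yes p∣x@(divides y refl) = record
    { exponent = suc e ; cofactor = c ; split = y*p≡p^[1+e]*c ; p∤cofactor = p∤c }
    where
    open PowerSplit (rec (quotient-< p∣x) {{m*n≢0⇒m≢0 y}})
      renaming (exponent to e; cofactor to c; p∤cofactor to p∤c)
    rearrange : ∀ a b c → a *ℕ b *ℕ c ≡ c *ℕ a *ℕ b
    rearrange = solve-∀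
    y*p≡p^[1+e]*c : y *ℕ p ≡ p ^ suc e *ℕ c
    y*p≡p^[1+e]*c = trans (cong (_*ℕ p) split) (rearrange (p ^ e) c p)

p^k∣p^v*y⇔k≤v : Prime p → ¬ p ∣ y → p ^ k ∣ p ^ v *ℕ y ⇔ k ≤ v
p^k∣p^v*y⇔k≤v {p} {y} {k} {v} pp p∤y = mk⇔ to (λ k≤v → ∣m⇒∣m*n y (^-monoʳ-∣ p k≤v))
  where
  instance _ = prime⇒nonZero pp
  instance _ = m^n≢0 p v
  to : p ^ k ∣ p ^ v *ℕ y → k ≤ v
  to p^k∣p^v*y with k ≤? v
  ... | yes k≤v = k≤v
  ... | no k≰v = contradiction (*-cancelˡ-∣ (p ^ v) p^v*p∣p^v*y) p∤y
    where
    p^v*p∣p^v*y : p ^ v *ℕ p ∣ p ^ v *ℕ y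
    p^v*p∣p^v*y =
      subst (_∣ p ^ v *ℕ y) (*-comm p (p ^ v)) (∣-trans (^-monoʳ-∣ p (≰⇒> k≰v)) p^k∣p^v*y)

lcm≢0 : ∀ m n → .{{NonZero m}} → .{{NonZero n}} → NonZero (lcm m n)
lcm≢0 m n = m*n≢0⇒n≢0 (gcd m n) {{subst NonZero (sym (gcd*lcm m n)) (m*n≢0 m n)}}

lcmList≢0 : ∀ {xs} → All NonZero xs → NonZero (lcmList xs)
lcmList≢0 [] = _
lcmList≢0 (x≢0 ∷ xs≢0) = lcm≢0 _ _ {{x≢0}} {{lcmList≢0 xs≢0}}

p^k∣lcm⇒p^k∣larger : Prime p → (sm : PowerSplit p m) (sn : PowerSplit p n) →
  PowerSplit.exponent sm ≤ PowerSplit.exponent sn → p ^ k ∣ lcm m n → p ^ k ∣ n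
p^k∣lcm⇒p^k∣larger {p} {m} {n} {k} pp sm sn a≤b p^k∣lcm = ∣-trans (^-monoʳ-∣ p k≤b) p^b∣n
  where
  open PowerSplit sm renaming (exponent to a; cofactor to m′; split to m≡p^a*m′; p∤cofactor to p∤m′)
  open PowerSplit sn renaming (exponent to b; cofactor to n′; split to n≡p^b*n′; p∤cofactor to p∤n′)
  m∣p^b*m′n′ : m ∣ p ^ b *ℕ (m′ *ℕ n′)
  m∣p^b*m′n′ = subst (_∣ p ^ b *ℕ (m′ *ℕ n′)) (sym m≡p^a*m′) (*-pres-∣ (^-monoʳ-∣ p a≤b) (m∣m*n n′))
  n∣p^b*m′n′ : n ∣ p ^ b *ℕ (m′ *ℕ n′)
  n∣p^b*m′n′ = subst (_∣ p ^ b *ℕ (m′ *ℕ n′)) (sym n≡p^b*n′) (*-monoʳ-∣ (p ^ b) (n∣m*n m′))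
  p∤m′n′ : ¬ p ∣ m′ *ℕ n′
  p∤m′n′ p∣m′n′ = [ p∤m′ , p∤n′ ]′ (euclidsLemma m′ n′ pp p∣m′n′)
  k≤b : k ≤ b
  k≤b = Equivalence.to (p^k∣p^v*y⇔k≤v pp p∤m′n′) (∣-trans p^k∣lcm (lcm-least m∣p^b*m′n′ n∣p^b*m′n′))
  p^b∣n : p ^ b ∣ n
  p^b∣n = subst (p ^ b ∣_) (sym n≡p^b*n′) (m∣m*n n′)

p^k∣lcm⇒∣⊎∣ : Prime p → ∀ m n → .{{NonZero m}} → .{{NonZero n}} →
  p ^ k ∣ lcm m n → (p ^ k ∣ m) ⊎ (p ^ k ∣ n)
p^k∣lcm⇒∣⊎∣ {p} {k} pp m n p^k∣lcm with powerSplit pp m | powerSplit pp n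
... | sm | sn with ≤-total (PowerSplit.exponent sm) (PowerSplit.exponent sn)
...   | inj₁ a≤b = inj₂ (p^k∣lcm⇒p^k∣larger {k = k} pp sm sn a≤b p^k∣lcm)
...   | inj₂ b≤a =
  inj₁ (p^k∣lcm⇒p^k∣larger {k = k} pp sn sm b≤a (subst (p ^ k ∣_) (lcm-comm m n) p^k∣lcm))

p^[1+k]∣lcmList⇔Any : Prime p → ∀ {xs} → All NonZero xs →
  p ^ suc k ∣ lcmList xs ⇔ Any (p ^ suc k ∣_) xs
p^[1+k]∣lcmList⇔Any {p} {k} pp xs≢0 = mk⇔ (to xs≢0) from
  where
  to : ∀ {xs} → All NonZero xs → p ^ suc k ∣ lcmList xs → Any (p ^ suc k ∣_) xs
  to [] p^[1+k]∣1 = contradiction (subst Prime (∣1⇒≡1 (∣-trans (m∣m*n (p ^ k)) p^[1+k]∣1)) pp) ¬prime[1]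
  to {x ∷ xs} (x≢0 ∷ xs≢0) p^[1+k]∣lcm
    with p^k∣lcm⇒∣⊎∣ {k = suc k} pp x (lcmList xs) {{x≢0}} {{lcmList≢0 xs≢0}} p^[1+k]∣lcm
  ... | inj₁ p^[1+k]∣x = here p^[1+k]∣x
  ... | inj₂ p^[1+k]∣lcm = there (to xs≢0 p^[1+k]∣lcm)
  from : ∀ {d xs} → Any (d ∣_) xs → d ∣ lcmList xs
  from {xs = x ∷ xs} (here d∣x) = ∣-trans d∣x (m∣lcm[m,n] x (lcmList xs))
  from {xs = x ∷ xs} (there d∣xs) = ∣-trans (from d∣xs) (n∣lcm[m,n] x (lcmList xs))

T-any⇔Any : ∀ {a ℓ} {X : Set a} {P : X → Set ℓ} (P? : Decidable P) xs →
  T (any (λ x → does (P? x)) xs) ⇔ Any P xs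
T-any⇔Any P? [] = mk⇔ (λ ()) (λ ())
T-any⇔Any P? (x ∷ xs) with P? x
... | yes px = mk⇔ (λ _ → here px) _
... | no ¬px = mk⇔ (there ∘ Equivalence.to ih) from
  where
  ih = T-any⇔Any P? xs
  from : Any _ (x ∷ xs) → T (any (λ x → does (P? x)) xs)
  from (here px) = contradiction px ¬px
  from (there pxs) = Equivalence.from ih pxs

isPowerᵇ : ℕ → ℕ → Bool
isPowerᵇ p m = any (λ k → does (p ^ suc k ≟ m)) (upTo m)

isPowerᵇ-sound : ∀ p m → isPowerᵇ p m ≡ true → ∃[ k ] p ^ suc k ≡ m
isPowerᵇ-sound p m ≡true =
  Any.satisfied (Equivalence.to (T-any⇔Any (λ k → p ^ suc k ≟ m) (upTo m)) (subst T (sym ≡true) _))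

isPowerᵇ-complete : ∀ p → p ^ suc j ≡ m → j < m → T (isPowerᵇ p m)
isPowerᵇ-complete {j} {m} p p^[1+j]≡m j<m =
  Equivalence.from (T-any⇔Any (λ k → p ^ suc k ≟ m) (upTo m))
                   (Any.map (λ { refl → p^[1+j]≡m }) (∈-upTo⁺ j<m))

expΛ-search : ℕ → List ℕ → ℕ
expΛ-search m [] = 1
expΛ-search m (p ∷ ps) =
  if does (prime? p) then (if isPowerᵇ p m then p else expΛ-search m ps) else expΛ-search m ps

expΛ-search-unique : ∀ m (f : List ℕ → ℕ) → f [] ≡ 1 →
  (∀ p ps → f (p ∷ ps) ≡ (if does (prime? p) then (if isPowerᵇ p m then p else f ps) else f ps)) →
  ∀ ps → f ps ≡ expΛ-search m ps
expΛ-search-unique m f f[] f∷ [] = f[]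
expΛ-search-unique m f f[] f∷ (p ∷ ps) rewrite f∷ p ps | expΛ-search-unique m f f[] f∷ ps = refl

-- The search loop of expΛ is local to its definition and cannot be named; once the list
-- it runs over is abstracted, unification instantiates f with it.
expΛ≡expΛ-search : ∀ m → expΛ m ≡ expΛ-search m (upTo (suc m))
expΛ≡expΛ-search m with expΛ-search-unique m _ refl (λ _ _ → refl) | applyUpTo suc m
... | go≡search | ps = go≡search ps

expΛ-search-shape : ∀ m ps →
  expΛ-search m ps ≡ 1 ⊎ ∃[ j ] (Prime (expΛ-search m ps) × expΛ-search m ps ^ suc j ≡ m)
expΛ-search-shape m [] = inj₁ refl
expΛ-search-shape m (p ∷ ps) with prime? p
... | no _ = expΛ-search-shape m ps
... | yes pp with isPowerᵇ p m in hit
...   | false = expΛ-search-shape m ps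
...   | true = inj₂ (proj₁ (isPowerᵇ-sound p m hit) , pp , proj₂ (isPowerᵇ-sound p m hit))

expΛ-search-hit : ∀ {ps} → Prime p → p ^ suc j ≡ m → j < m → p ∈ ps → expΛ-search m ps ≡ p
expΛ-search-hit {p} {j} {m} pp p^[1+j]≡m j<m (here refl) with prime? p
... | no ¬pp = contradiction pp ¬pp
... | yes _ with isPowerᵇ p m in hit
...   | true = refl
...   | false = ⊥-elim (subst T hit (isPowerᵇ-complete p p^[1+j]≡m j<m))
expΛ-search-hit {p} {j} {m} {x ∷ ps} pp p^[1+j]≡m j<m (there p∈ps) with prime? x
... | no _ = expΛ-search-hit pp p^[1+j]≡m j<m p∈ps
... | yes px with isPowerᵇ x m in hit
...   | false = expΛ-search-hit pp p^[1+j]≡m j<m p∈ps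
...   | true with k , x^[1+k]≡m ← isPowerᵇ-sound x m hit =
  prime^≡prime^⇒≡ {j = k} {k = j} px pp (trans x^[1+k]≡m (sym p^[1+j]≡m))

data ExpΛView : ℕ → Set where
  expΛ≡1 : expΛ m ≡ 1 → ExpΛView m
  prime^ : Prime p → ∀ j → ExpΛView (p ^ suc j)

expΛ-view : ∀ m → ExpΛView m
expΛ-view m with expΛ-search-shape m (upTo (suc m))
... | inj₁ search≡1 = expΛ≡1 (trans (expΛ≡expΛ-search m) search≡1)
... | inj₂ (j , pp , p^[1+j]≡m) = subst ExpΛView p^[1+j]≡m (prime^ pp j)

expΛ[p^[1+j]]≡p : Prime p → ∀ j → expΛ (p ^ suc j) ≡ p
expΛ[p^[1+j]]≡p {p} pp j =
  trans (expΛ≡expΛ-search (p ^ suc j)) (expΛ-search-hit pp refl j<p^[1+j] p∈upTo)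
  where
  instance _ = prime⇒nonZero pp
  j<p^[1+j] : j < p ^ suc j
  j<p^[1+j] = <-trans (n<1+n j) (n<m^n (nonTrivial⇒n>1 p {{prime⇒nonTrivial pp}}))
  p∈upTo : p ∈ upTo (suc (p ^ suc j))
  p∈upTo = ∈-upTo⁺ (s≤s (m≤m*n p (p ^ j) {{m^n≢0 p j}}))

∏[1‥_] : ℕ → (ℕ → ℕ) → ℕ
∏[1‥ zero ] f = 1
∏[1‥ suc M ] f = ∏[1‥ M ] f *ℕ f (suc M)

product-map-suc-upTo : ∀ (f : ℕ → ℕ) M → product (map f (map suc (upTo M))) ≡ ∏[1‥ M ] f
product-map-suc-upTo f zero = refl
product-map-suc-upTo f (suc M) = begin
  product (map f (map suc (upTo (suc M))))
    ≡⟨ cong (product ∘ map f ∘ map suc) (upTo-∷ʳ M) ⟨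
  product (map f (map suc (upTo M ∷ʳ M)))
    ≡⟨ cong product (trans (cong (map f) (map-++ suc (upTo M) [ M ])) (map-++ f _ [ suc M ])) ⟩
  product (map f (map suc (upTo M)) ++ [ f (suc M) ])
    ≡⟨ product-++ (map f (map suc (upTo M))) [ f (suc M) ] ⟩
  product (map f (map suc (upTo M))) *ℕ (f (suc M) *ℕ 1)
    ≡⟨ cong₂ _*ℕ_ (product-map-suc-upTo f M) (*-identityʳ (f (suc M))) ⟩
  ∏[1‥ suc M ] f ∎
  where open ≡-Reasoning

∏-cong : ∀ {f g} M → f ≗ g → ∏[1‥ M ] f ≡ ∏[1‥ M ] g
∏-cong zero f≗g = refl
∏-cong (suc M) f≗g = cong₂ _*ℕ_ (∏-cong M f≗g) (f≗g (suc M))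

∏-distrib-* : ∀ f g M → ∏[1‥ M ] (λ m → f m *ℕ g m) ≡ ∏[1‥ M ] f *ℕ ∏[1‥ M ] g
∏-distrib-* f g zero = refl
∏-distrib-* f g (suc M) rewrite ∏-distrib-* f g M =
  interchange (∏[1‥ M ] f) (∏[1‥ M ] g) (f (suc M)) (g (suc M))
  where
  interchange : ∀ a b c d → a *ℕ b *ℕ (c *ℕ d) ≡ a *ℕ c *ℕ (b *ℕ d)
  interchange = solve-∀

∏-≡1 : ∀ {f} M → (∀ {m} → m ≤ M → f m ≡ 1) → ∏[1‥ M ] f ≡ 1
∏-≡1 zero f≡1 = refl
∏-≡1 (suc M) f≡1 = cong₂ _*ℕ_ (∏-≡1 M (f≡1 ∘ m≤n⇒m≤1+n)) (f≡1 ≤-refl)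

mulSingle : ℕ → ℕ → ℕ → ℕ
mulSingle c x m = if does (m ≟ c) then x else 1

mulSingle-same : ∀ c x → mulSingle c x c ≡ x
mulSingle-same c x = cong (if_then x else 1) (dec-true (c ≟ c) refl)

mulSingle-other : ∀ {c m} x → m ≢ c → mulSingle c x m ≡ 1
mulSingle-other {c} {m} x m≢c = cong (if_then x else 1) (dec-false (m ≟ c) m≢c)

∏-mulSingle : ∀ {c} x M → 1 ≤ c → c ≤ M → ∏[1‥ M ] (mulSingle c x) ≡ x
∏-mulSingle x zero 1≤c c≤0 = contradiction (≤-trans 1≤c c≤0) λ ()
∏-mulSingle x (suc M) 1≤c c≤1+M with m≤n⇒m<n∨m≡n c≤1+M
... | inj₁ c<1+M =
  trans (cong₂ _*ℕ_ (∏-mulSingle x M 1≤c (≤-pred c<1+M)) (mulSingle-other x (>⇒≢ c<1+M)))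
        (*-identityʳ x)
... | inj₂ refl =
  trans (cong₂ _*ℕ_ (∏-≡1 M (λ m≤M → mulSingle-other x (<⇒≢ (s≤s m≤M)))) (mulSingle-same (suc M) x))
        (*-identityˡ x)

if-≡1 : ∀ b {x} → x ≡ 1 → (if b then x else 1) ≡ 1
if-≡1 true x≡1 = x≡1
if-≡1 false _ = refl

expΛ∣ : ℕ → ℕ → ℕ
expΛ∣ L m = if does (m ∣? L) then expΛ m else 1

expΛ∣-∣ : ∀ {L} → m ∣ L → expΛ∣ L m ≡ expΛ m
expΛ∣-∣ {m} {L} m∣L = cong (if_then expΛ m else 1) (dec-true (m ∣? L) m∣L)

expΛ∣-∤ : ∀ {L} → ¬ m ∣ L → expΛ∣ L m ≡ 1
expΛ∣-∤ {m} {L} m∤L = cong (if_then expΛ m else 1) (dec-false (m ∣? L) m∤L)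

expΛ∣-1 : ∀ m → expΛ∣ 1 m ≡ 1
expΛ∣-1 m with m ∣? 1
... | yes m∣1 rewrite ∣1⇒≡1 m∣1 = refl
... | no _ = refl

expΛ∣-*prime-coprime : Prime p → Prime q → q ≢ p → ∀ X j →
  expΛ∣ (p *ℕ X) (q ^ suc j) ≡ expΛ∣ X (q ^ suc j) *ℕ mulSingle (p ^ suc v) p (q ^ suc j)
expΛ∣-*prime-coprime {p} {q} {v} pp pq q≢p X j = begin
  expΛ∣ (p *ℕ X) (q ^ suc j)
    ≡⟨ cong (if_then expΛ (q ^ suc j) else 1) (does-⇔ ∣pX⇔∣X (_ ∣? _) (_ ∣? _)) ⟩
  expΛ∣ X (q ^ suc j)
    ≡⟨ *-identityʳ _ ⟨
  expΛ∣ X (q ^ suc j) *ℕ 1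
    ≡⟨ cong (expΛ∣ X (q ^ suc j) *ℕ_) (mulSingle-other p (q≢p ∘ prime^≡prime^⇒≡ {j = j} {k = v} pq pp)) ⟨
  expΛ∣ X (q ^ suc j) *ℕ mulSingle (p ^ suc v) p (q ^ suc j) ∎
  where
  open ≡-Reasoning
  p∤q^[1+j] : ¬ p ∣ q ^ suc j
  p∤q^[1+j] p∣q^[1+j] = q≢p (sym (prime∣prime⇒≡ pp pq (prime∣^⇒∣ {k = suc j} pp p∣q^[1+j])))
  ∣pX⇔∣X : (q ^ suc j ∣ p *ℕ X) ⇔ (q ^ suc j ∣ X)
  ∣pX⇔∣X = mk⇔ (coprime-divisor (Coprime-sym (prime∤⇒coprime pp p∤q^[1+j]))) (∣n⇒∣m*n p)

expΛ∣-*prime-same : Prime p → ¬ p ∣ y → ∀ j →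
  expΛ∣ (p *ℕ (p ^ v *ℕ y)) (p ^ suc j)
    ≡ expΛ∣ (p ^ v *ℕ y) (p ^ suc j) *ℕ mulSingle (p ^ suc v) p (p ^ suc j)
expΛ∣-*prime-same {p} {y} {v} pp p∤y j = compare (<-cmp j v)
  where
  open Equivalence
  1<p : 1 < p
  1<p = nonTrivial⇒n>1 p {{prime⇒nonTrivial pp}}
  ∣X⇔ : (p ^ suc j ∣ p ^ v *ℕ y) ⇔ (j < v)
  ∣X⇔ = p^k∣p^v*y⇔k≤v pp p∤y
  ∣pX⇔ : (p ^ suc j ∣ p *ℕ (p ^ v *ℕ y)) ⇔ (suc j ≤ suc v)
  ∣pX⇔ = subst (λ pX → (p ^ suc j ∣ pX) ⇔ (suc j ≤ suc v)) (*-assoc p (p ^ v) y) (p^k∣p^v*y⇔k≤v pp p∤y)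
  compare : Tri (j < v) (j ≡ v) (v < j) →
    expΛ∣ (p *ℕ (p ^ v *ℕ y)) (p ^ suc j)
      ≡ expΛ∣ (p ^ v *ℕ y) (p ^ suc j) *ℕ mulSingle (p ^ suc v) p (p ^ suc j)
  compare (tri< j<v _ _) =
    trans (expΛ∣-∣ (∣pX⇔ .from (m≤n⇒m≤1+n j<v)))
          (sym (trans (cong₂ _*ℕ_ (expΛ∣-∣ (∣X⇔ .from j<v))
                                  (mulSingle-other p (<⇒≢ (^-monoʳ-< p 1<p (s<s j<v)))))
                      (*-identityʳ _)))
  compare (tri≈ _ refl _) =
    trans (trans (expΛ∣-∣ (∣pX⇔ .from ≤-refl)) (expΛ[p^[1+j]]≡p pp j))
          (sym (trans (cong₂ _*ℕ_ (expΛ∣-∤ (n≮n j ∘ ∣X⇔ .to)) (mulSingle-same (p ^ suc j) p))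
                      (*-identityˡ p)))
  compare (tri> _ _ v<j) =
    trans (expΛ∣-∤ (<⇒≱ (s<s v<j) ∘ ∣pX⇔ .to))
          (sym (cong₂ _*ℕ_ (expΛ∣-∤ (<-asym v<j ∘ ∣X⇔ .to))
                           (mulSingle-other p (>⇒≢ (^-monoʳ-< p 1<p (s<s v<j))))))

expΛ∣-*prime : Prime p → ¬ p ∣ y → ∀ m →
  expΛ∣ (p *ℕ (p ^ v *ℕ y)) m ≡ expΛ∣ (p ^ v *ℕ y) m *ℕ mulSingle (p ^ suc v) p m
expΛ∣-*prime {p} {y} {v} pp p∤y m with expΛ-view m
... | expΛ≡1 expΛm≡1 =
  trans (if-≡1 (does (m ∣? p *ℕ (p ^ v *ℕ y))) expΛm≡1)
        (sym (cong₂ _*ℕ_ (if-≡1 (does (m ∣? p ^ v *ℕ y)) expΛm≡1) (mulSingle-other p m≢p^[1+v])))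
  where
  m≢p^[1+v] : m ≢ p ^ suc v
  m≢p^[1+v] refl = ¬prime[1] (subst Prime (trans (sym (expΛ[p^[1+j]]≡p pp v)) expΛm≡1) pp)
... | prime^ {q} pq j with q ≟ p
...   | yes refl = expΛ∣-*prime-same {v = v} pp p∤y j
...   | no q≢p = expΛ∣-*prime-coprime {v = v} pp pq q≢p _ j

∏-expΛ∣-*prime : Prime p → ∀ X M → .{{NonZero X}} → p *ℕ X ≤ M →
  ∏[1‥ M ] (expΛ∣ X) ≡ X → ∏[1‥ M ] (expΛ∣ (p *ℕ X)) ≡ p *ℕ X
∏-expΛ∣-*prime {p} pp X M pX≤M ∏≡X with powerSplit pp X
... | record { exponent = v ; cofactor = y ; split = refl ; p∤cofactor = p∤y } = begin
  ∏[1‥ M ] (expΛ∣ (p *ℕ X))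
    ≡⟨ ∏-cong M (expΛ∣-*prime {v = v} pp p∤y) ⟩
  ∏[1‥ M ] (λ m → expΛ∣ X m *ℕ mulSingle (p ^ suc v) p m)
    ≡⟨ ∏-distrib-* _ _ M ⟩
  ∏[1‥ M ] (expΛ∣ X) *ℕ ∏[1‥ M ] (mulSingle (p ^ suc v) p)
    ≡⟨ cong₂ _*ℕ_ ∏≡X (∏-mulSingle p M 1≤p^[1+v] p^[1+v]≤M) ⟩
  X *ℕ p
    ≡⟨ *-comm X p ⟩
  p *ℕ X ∎
  where
  open ≡-Reasoning
  instance _ = prime⇒nonZero pp
  1≤p^[1+v] : 1 ≤ p ^ suc v
  1≤p^[1+v] = m^n>0 p (suc v)
  p^[1+v]≤M : p ^ suc v ≤ M
  p^[1+v]≤M = ≤-trans (∣⇒≤ {{m*n≢0 p X}} (*-monoʳ-∣ p (m∣m*n y))) pX≤M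

∏-expΛ∣-product : ∀ {fs} → All Prime fs → ∀ M → product fs ≤ M →
  ∏[1‥ M ] (expΛ∣ (product fs)) ≡ product fs
∏-expΛ∣-product [] M _ = ∏-≡1 M (λ {m} _ → expΛ∣-1 m)
∏-expΛ∣-product {p ∷ fs} (pp ∷ fsPrime) M pX≤M =
  ∏-expΛ∣-*prime pp (product fs) M pX≤M (∏-expΛ∣-product fsPrime M (≤-trans (m≤n*m (product fs) p) pX≤M))
  where
  instance
    _ = prime⇒nonZero pp
    _ = productOfPrimes≢0 fsPrime

∏-expΛ∣ : ∀ L M → .{{NonZero L}} → L ≤ M → ∏[1‥ M ] (expΛ∣ L) ≡ L
∏-expΛ∣ L M L≤M with factorise L
... | record { factors = fs ; isFactorisation = refl ; factorsPrime = fsPrime } =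
  ∏-expΛ∣-product fsPrime M L≤M

odd-+ : ∀ m n → odd (m +ℕ n) ≡ odd m xor odd n
odd-+ zero n = refl
odd-+ (suc m) n rewrite odd-+ m n with odd m | odd n
... | true | true = refl
... | true | false = refl
... | false | true = refl
... | false | false = refl

-- Ring identities in the exact shape the goals below take once the parities are fixed
-- (hence the factors + 1).
private
  addition₀ : ∀ c2 s x y → x ≡ + 1 * + 1 * x - c2 * s * + 0 * y
  addition₀ = ℤ-solve-∀
  addition₁ : ∀ c2 f x y → f * x - c2 * y ≡ f * (+ 1 * + 1 - c2 * + 0) * x - c2 * + 1 * + 1 * y
  addition₁ = ℤ-solve-∀
  addition-odd : ∀ c2 f0 f1 a b x y →
    f0 * (f1 * (f0 * b - c2 * a) * y - c2 * + 1 * b * x) - c2 * (f0 * b * y - c2 * + 1 * a * x)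
      ≡ f0 * (f1 * (f0 * b - c2 * a) - c2 * b) * y - c2 * + 1 * (f0 * b - c2 * a) * x
  addition-odd = ℤ-solve-∀
  addition-even : ∀ c2 f0 f1 a b x y →
    f1 * (+ 1 * (f0 * b - c2 * a) * y - c2 * f0 * b * x) - c2 * (+ 1 * b * y - c2 * f1 * a * x)
      ≡ + 1 * (f1 * (f0 * b - c2 * a) - c2 * b) * y - c2 * f1 * (f0 * b - c2 * a) * x
  addition-even = ℤ-solve-∀

  casoratian₀ : ∀ c1 z → + 1 * + 1 * + 1 - c1 * + 0 * z ≡ + 1
  casoratian₀ = ℤ-solve-∀
  casoratian-even : ∀ c1 c2 a b →
    c1 * (+ 1 * b - c2 * a) * (+ 1 * b - c2 * a) - + 1 * b * (c1 * (+ 1 * b - c2 * a) - c2 * b)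
      ≡ c2 * (+ 1 * b * b - c1 * a * (+ 1 * b - c2 * a))
  casoratian-even = ℤ-solve-∀
  casoratian-odd : ∀ c1 c2 a b →
    + 1 * (c1 * b - c2 * a) * (c1 * b - c2 * a) - c1 * b * (+ 1 * (c1 * b - c2 * a) - c2 * b)
      ≡ c2 * (c1 * b * b - + 1 * a * (c1 * b - c2 * a))
  casoratian-odd = ℤ-solve-∀

module LehmerSequence (c1 c2 : ℤ) where
  u : ℕ → ℤ
  u = lehmer c1 c2

  F : ℕ → ℤ
  F k = if odd k then c1 else + 1

  F-+ : ∀ m n → F (m +ℕ n) ≡ (if odd m xor odd n then c1 else + 1)
  F-+ m n = cong (if_then c1 else + 1) (odd-+ m n)

  -- With U_j = (ζ^j - η^j)/(ζ - η) one has U_j = ũ_j (ζ + η)^[j even], so in the classical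
  -- U_{r+k+1} = U_{r+1} U_{k+1} - c2 U_r U_k a term acquires the factor c1 = (ζ + η)²
  -- exactly when both of its indices are even.
  α β : ℕ → ℕ → ℤ
  α r k = if odd k then F r else + 1
  β r k = if odd k then + 1 else F (suc r)

  u-+ : ∀ r k → u (r +ℕ suc k) ≡ α r k * u (suc r) * u (suc k) - c2 * β r k * u r * u k
  u-+ zero k with odd k
  ... | true = addition₀ c2 (+ 1) (u (suc k)) (u k)
  ... | false = addition₀ c2 c1 (u (suc k)) (u k)
  u-+ (suc zero) k with odd k
  ... | true = addition₁ c2 c1 (u (suc k)) (u k)
  ... | false = addition₁ c2 (+ 1) (u (suc k)) (u k)
  u-+ (suc (suc r)) k = begin
    F (r +ℕ suc k) * u (suc r +ℕ suc k) - c2 * u (r +ℕ suc k)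
      ≡⟨ cong₂ (λ s t → F (r +ℕ suc k) * s - c2 * t) (u-+ (suc r) k) (u-+ r k) ⟩
    F (r +ℕ suc k) * P - c2 * Q
      ≡⟨ cong (λ f → f * P - c2 * Q) (F-+ r (suc k)) ⟩
    (if odd r xor odd (suc k) then c1 else + 1) * P - c2 * Q
      ≡⟨ step ⟩
    α (suc (suc r)) k * u (suc (suc (suc r))) * u (suc k) - c2 * β (suc (suc r)) k * u (suc (suc r)) * u k ∎
    where
    open ≡-Reasoning
    P = α (suc r) k * u (suc (suc r)) * u (suc k) - c2 * β (suc r) k * u (suc r) * u k
    Q = α r k * u (suc r) * u (suc k) - c2 * β r k * u r * u k
    step : (if odd r xor odd (suc k) then c1 else + 1) * P - c2 * Q
      ≡ α (suc (suc r)) k * u (suc (suc (suc r))) * u (suc k) - c2 * β (suc (suc r)) k * u (suc (suc r)) * u k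
    step with odd r | odd k
    ... | true  | true  = addition-odd c2 c1 (+ 1) (u r) (u (suc r)) (u k) (u (suc k))
    ... | false | true  = addition-odd c2 (+ 1) c1 (u r) (u (suc r)) (u k) (u (suc k))
    ... | true  | false = addition-even c2 c1 (+ 1) (u r) (u (suc r)) (u k) (u (suc k))
    ... | false | false = addition-even c2 (+ 1) c1 (u r) (u (suc r)) (u k) (u (suc k))

  casoratian : ℕ → ℤ
  casoratian r = F r * u (suc r) * u (suc r) - F (suc r) * u r * u (suc (suc r))

  casoratian≡c2^ : ∀ r → casoratian r ≡ c2 ℤ.^ r
  casoratian≡c2^ zero = casoratian₀ c1 (u 2)
  casoratian≡c2^ (suc r) = trans step (cong (c2 *_) (casoratian≡c2^ r))
    where
    step : casoratian (suc r) ≡ c2 * casoratian r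
    step with odd r
    ... | false = casoratian-even c1 c2 (u r) (u (suc r))
    ... | true = casoratian-odd c1 c2 (u r) (u (suc r))

  ∣u-+ : ∀ r k → m ∣ ∣ u r ∣ → m ∣ ∣ u k ∣ → m ∣ ∣ u (r +ℕ k) ∣
  ∣u-+ {m} r zero m∣ur _ = subst (λ i → m ∣ ∣ u i ∣) (sym (+-identityʳ r)) m∣ur
  ∣u-+ {m} r (suc k) m∣ur m∣u[1+k] = ∣⇒∣ᵤ (subst (+ m ∣ℤ_) (sym (u-+ r k))
    (∣m∣n⇒∣m-n (∣n⇒∣m*nℤ (α r k * u (suc r)) (∣ᵤ⇒∣ {i = u (suc k)} m∣u[1+k]))
                (∣m⇒∣m*nℤ (u k) (∣n⇒∣m*nℤ (c2 * β r k) (∣ᵤ⇒∣ {i = u r} m∣ur)))))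

  ∣u-multiple : ∀ {r a} → m ∣ ∣ u r ∣ → r ∣ a → m ∣ ∣ u a ∣
  ∣u-multiple {m} m∣ur (divides zero refl) = m ∣0
  ∣u-multiple {r = r} m∣ur (divides (suc q) refl) =
    ∣u-+ r (q *ℕ r) m∣ur (∣u-multiple m∣ur (divides q refl))

  ∣u⇒coprime-F*u[1+r] : ∀ {r} → Coprime m ∣ c2 ∣ → m ∣ ∣ u r ∣ → Coprime m ∣ F r * u (suc r) ∣
  ∣u⇒coprime-F*u[1+r] {m} {r} m⊥c2 m∣ur {d} (d∣m , d∣Fu) =
    coprime∧∣^⇒≡1 r (Coprime-∣ˡ d∣m m⊥c2) (∣⇒∣ᵤ d∣c2^r)
    where
    d∣c2^r : + d ∣ℤ c2 ℤ.^ r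
    d∣c2^r = subst (+ d ∣ℤ_) (casoratian≡c2^ r)
      (∣m∣n⇒∣m-n (∣m⇒∣m*nℤ (u (suc r)) (∣ᵤ⇒∣ {i = F r * u (suc r)} d∣Fu))
                  (∣m⇒∣m*nℤ (u (suc (suc r))) (∣n⇒∣m*nℤ (F (suc r)) (∣ᵤ⇒∣ {i = u r} (∣-trans d∣m m∣ur)))))

  ∣u-+⁻ : ∀ r k → Coprime m ∣ c2 ∣ → m ∣ ∣ u r ∣ → m ∣ ∣ u (r +ℕ k) ∣ → m ∣ ∣ u k ∣
  ∣u-+⁻ {m} r zero _ _ _ = m ∣0
  ∣u-+⁻ {m} r (suc k) m⊥c2 m∣ur m∣u[r+1+k] =
    ℤCoprime.coprime-divisor (+ m) (α r k * u (suc r)) (u (suc k)) m⊥αu (∣⇒∣ᵤ m∣αu*u)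
    where
    m∣αu*u : + m ∣ℤ α r k * u (suc r) * u (suc k)
    m∣αu*u = ∣m+n∣n⇒∣m (subst (+ m ∣ℤ_) (u-+ r k) (∣ᵤ⇒∣ {i = u (r +ℕ suc k)} m∣u[r+1+k]))
                        (∣m⇒∣-m (∣m⇒∣m*nℤ (u k) (∣n⇒∣m*nℤ (c2 * β r k) (∣ᵤ⇒∣ {i = u r} m∣ur))))
    α∣F : ∣ α r k ∣ ∣ ∣ F r ∣
    α∣F with odd k
    ... | true = ∣-refl
    ... | false = 1∣ _
    m⊥αu : Coprime m ∣ α r k * u (suc r) ∣
    m⊥αu = Coprime-∣ʳ (ℤ∣ᵤ.*-monoˡ-∣ (u (suc r)) {α r k} {F r} α∣F)
                      (∣u⇒coprime-F*u[1+r] {r = r} m⊥c2 m∣ur)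

  ∣u⇒rank∣ : ∀ {r a} → Coprime m ∣ c2 ∣ → 1 ≤ r → m ∣ ∣ u r ∣ →
    (∀ {k} → 1 ≤ k → k < r → ¬ m ∣ ∣ u k ∣) → m ∣ ∣ u a ∣ → r ∣ a
  ∣u⇒rank∣ {m} {r} {a} m⊥c2 1≤r m∣ur minimal m∣ua = m%n≡0⇒n∣m a r a%r≡0
    where
    instance _ = >-nonZero 1≤r
    a≡ : a / r *ℕ r +ℕ a % r ≡ a
    a≡ = trans (+-comm (a / r *ℕ r) (a % r)) (sym (m≡m%n+[m/n]*n a r))
    m∣u[a%r] : m ∣ ∣ u (a % r) ∣
    m∣u[a%r] = ∣u-+⁻ (a / r *ℕ r) (a % r) m⊥c2 (∣u-multiple m∣ur (n∣m*n (a / r)))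
                     (subst (λ i → m ∣ ∣ u i ∣) (sym a≡) m∣ua)
    a%r≡0 : a % r ≡ 0
    a%r≡0 with a % r ≟ 0
    ... | yes a%r≡0 = a%r≡0
    ... | no a%r≢0 = contradiction m∣u[a%r] (minimal (n≢0⇒n>0 a%r≢0) (m%n<n a r))

  c2⊥u[1+k] : Coprime ∣ c1 ∣ ∣ c2 ∣ → ∀ k → Coprime ∣ c2 ∣ ∣ u (suc k) ∣
  c2⊥u[1+k] c1⊥c2 zero (_ , d∣1) = ∣1⇒≡1 d∣1
  c2⊥u[1+k] c1⊥c2 (suc k) {d} (d∣c2 , d∣u[2+k]) = c2⊥u[1+k] c1⊥c2 k (d∣c2 , d∣u[1+k])
    where
    d⊥Fk : Coprime d ∣ F k ∣
    d⊥Fk with odd k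
    ... | true = Coprime-∣ˡ d∣c2 (Coprime-sym c1⊥c2)
    ... | false = Coprime-sym (1-coprimeTo d)
    d∣Fu : + d ∣ℤ F k * u (suc k)
    d∣Fu = ∣m+n∣n⇒∣m (∣ᵤ⇒∣ {i = u (suc (suc k))} d∣u[2+k])
                      (∣m⇒∣-m (∣m⇒∣m*nℤ (u k) (∣ᵤ⇒∣ {i = c2} d∣c2)))
    d∣u[1+k] : d ∣ ∣ u (suc k) ∣
    d∣u[1+k] = ℤCoprime.coprime-divisor (+ d) (F k) (u (suc k)) d⊥Fk (∣⇒∣ᵤ d∣Fu)

  ∣u⇒coprime-c2 : ∀ {a} → Coprime ∣ c1 ∣ ∣ c2 ∣ → 1 ≤ a → m ∣ ∣ u a ∣ → Coprime m ∣ c2 ∣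
  ∣u⇒coprime-c2 {a = suc a} c1⊥c2 _ m∣ua = Coprime-∣ˡ m∣ua (Coprime-sym (c2⊥u[1+k] c1⊥c2 a))

  data Rank (m n : ℕ) : Maybe ℕ → Set where
    none  : (∀ {k} → 1 ≤ k → k ≤ n → ¬ m ∣ ∣ u k ∣) → Rank m n nothing
    least : ∀ {r} → 1 ≤ r → m ∣ ∣ u r ∣ → (∀ {k} → 1 ≤ k → k < r → ¬ m ∣ ∣ u k ∣) → Rank m n (just r)

  firstDivIn-++ : ∀ m xs ys →
    firstDivIn c1 c2 m (xs ++ ys) ≡ firstDivIn c1 c2 m xs <∣> firstDivIn c1 c2 m ys
  firstDivIn-++ m [] ys = refl
  firstDivIn-++ m (x ∷ xs) ys with does (m ∣? ∣ u x ∣)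
  ... | true = refl
  ... | false = firstDivIn-++ m xs ys

  rankUpTo-suc : ∀ m n → rankUpTo c1 c2 m (suc n) ≡ rankUpTo c1 c2 m n <∣> firstDivIn c1 c2 m [ suc n ]
  rankUpTo-suc m n =
    trans (cong (firstDivIn c1 c2 m) (trans (cong (map suc) (sym (upTo-∷ʳ n))) (map-++ suc (upTo n) [ n ])))
          (firstDivIn-++ m (map suc (upTo n)) [ suc n ])

  rank-view : ∀ m n → Rank m n (rankUpTo c1 c2 m n)
  rank-view m zero = none (λ 1≤k k≤0 → contradiction (≤-trans 1≤k k≤0) λ ())
  rank-view m (suc n) rewrite rankUpTo-suc m n with rankUpTo c1 c2 m n | rank-view m n
  ... | just r | least 1≤r m∣ur minimal = least 1≤r m∣ur minimal
  ... | nothing | none none≤n with m ∣? ∣ u (suc n) ∣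
  ...   | yes m∣u = least (s≤s z≤n) m∣u (λ 1≤k k<1+n → none≤n 1≤k (≤-pred k<1+n))
  ...   | no m∤u = none λ 1≤k k≤1+n →
    [ none≤n 1≤k ∘ ≤-pred , (λ { refl → m∤u }) ]′ (m≤n⇒m<n∨m≡n k≤1+n)

  indicator⇔ : Coprime m ∣ c2 ∣ → All (λ a → 1 ≤ a × a ≤ n) A →
    T (indicator c1 c2 n A m) ⇔ Any (λ a → m ∣ ∣ u a ∣) A
  indicator⇔ {m} {n} {A} m⊥c2 A⊆[1,n] with rankUpTo c1 c2 m n | rank-view m n
  ... | nothing | none none≤n = mk⇔ (λ ()) λ m∣uA →
    let (1≤a , a≤n) , m∣ua = lookupAny A⊆[1,n] m∣uA in none≤n 1≤a a≤n m∣ua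
  ... | just r | least 1≤r m∣ur minimal =
    mk⇔ (Any.map (∣u-multiple m∣ur) ∘ to) (from ∘ Any.map (∣u⇒rank∣ m⊥c2 1≤r m∣ur minimal))
    where open Equivalence (T-any⇔Any (r ∣?_) A)

  prime^∣lcm-u⇔Any : Prime p → All (λ a → NonZero ∣ u a ∣) A →
    (p ^ suc j ∣ lcmList (map (λ a → ∣ u a ∣) A)) ⇔ Any (λ a → p ^ suc j ∣ ∣ u a ∣) A
  prime^∣lcm-u⇔Any {j = j} pp uA≢0 = mk⇔ (Anyₚ.map⁻ ∘ to) (from ∘ Anyₚ.map⁺)
    where open Equivalence (p^[1+k]∣lcmList⇔Any {k = j} pp (Allₚ.map⁺ uA≢0))

  weight≡expΛ∣-prime^ : Coprime ∣ c1 ∣ ∣ c2 ∣ → All (λ a → 1 ≤ a × a ≤ n) A →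
    All (λ a → NonZero ∣ u a ∣) A → Prime p → ∀ j →
    weight c1 c2 n A (p ^ suc j) ≡ expΛ∣ (lcmList (map (λ a → ∣ u a ∣) A)) (p ^ suc j)
  weight≡expΛ∣-prime^ {n} {A} {p} c1⊥c2 A⊆[1,n] uA≢0 pp j = by-coprimality (coprime? p^[1+j] ∣ c2 ∣)
    where
    p^[1+j] = p ^ suc j
    L = lcmList (map (λ a → ∣ u a ∣) A)
    ∣L⇔ : (p^[1+j] ∣ L) ⇔ Any (λ a → p^[1+j] ∣ ∣ u a ∣) A
    ∣L⇔ = prime^∣lcm-u⇔Any {j = j} pp uA≢0
    indicatorBranch = if indicator c1 c2 n A p^[1+j] then expΛ p^[1+j] else 1
    by-coprimality : Dec (Coprime p^[1+j] ∣ c2 ∣) → weight c1 c2 n A p^[1+j] ≡ expΛ∣ L p^[1+j]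
    by-coprimality (yes p^[1+j]⊥c2) =
      trans (cong (if_then indicatorBranch else 1) (dec-true (coprime? p^[1+j] ∣ c2 ∣) p^[1+j]⊥c2))
            (cong (if_then expΛ p^[1+j] else 1) indicator≡does)
      where
      open Equivalence
      ind⇔ = indicator⇔ p^[1+j]⊥c2 A⊆[1,n]
      indicator≡does : indicator c1 c2 n A p^[1+j] ≡ does (p^[1+j] ∣? L)
      indicator≡does =
        det (fromEquivalence (from ∣L⇔ ∘ to ind⇔) (from ind⇔ ∘ to ∣L⇔)) (proof (p^[1+j] ∣? L))
    by-coprimality (no ¬p^[1+j]⊥c2) =
      trans (cong (if_then indicatorBranch else 1) (dec-false (coprime? p^[1+j] ∣ c2 ∣) ¬p^[1+j]⊥c2))
            (sym (expΛ∣-∤ λ p^[1+j]∣L →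
              let (1≤a , _) , p^[1+j]∣ua = lookupAny A⊆[1,n] (Equivalence.to ∣L⇔ p^[1+j]∣L)
              in ¬p^[1+j]⊥c2 (∣u⇒coprime-c2 c1⊥c2 1≤a p^[1+j]∣ua)))

  weight≡expΛ∣ : Coprime ∣ c1 ∣ ∣ c2 ∣ → All (λ a → 1 ≤ a × a ≤ n) A → All (λ a → NonZero ∣ u a ∣) A →
    weight c1 c2 n A ≗ expΛ∣ (lcmList (map (λ a → ∣ u a ∣) A))
  weight≡expΛ∣ {n} {A} c1⊥c2 A⊆[1,n] uA≢0 m with expΛ-view m
  ... | expΛ≡1 expΛm≡1 =
    trans (if-≡1 (does (coprime? m ∣ c2 ∣)) (if-≡1 (indicator c1 c2 n A m) expΛm≡1))
          (sym (if-≡1 (does (m ∣? lcmList (map (λ a → ∣ u a ∣) A))) expΛm≡1))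
  ... | prime^ pp j = weight≡expΛ∣-prime^ c1⊥c2 A⊆[1,n] uA≢0 pp j

lemma5p1 : (a1 a2 c1 c2 : ℤ) → a1 ≢ + 0 → a2 ≢ + 0
    → a1 * a1 + + 4 * a2 ≢ + 0
    → (∀ k → 1 ≤ k → lehmer c1 c2 k ≢ + 0)
    → bOf a1 a2 * c1 ≡ a1 * a1
    → bOf a1 a2 * c2 ≡ - a2
    → (n : ℕ) → 1 ≤ n
    → (A : List ℕ) → All (λ a → 1 ≤ a × a ≤ n) A
    → ∃[ N ] (∀ M → N ≤ M
        → partialProd c1 c2 n A M ≡ lcmList (map (λ a → ∣ lehmer c1 c2 a ∣) A))
lemma5p1 a1 a2 c1 c2 a1≢0 _ _ u≢0 b*c1≡a1*a1 b*c2≡-a2 n _ A A⊆[1,n] = L , λ M L≤M → begin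
  partialProd c1 c2 n A M      ≡⟨ product-map-suc-upTo (weight c1 c2 n A) M ⟩
  ∏[1‥ M ] (weight c1 c2 n A)  ≡⟨ ∏-cong M (weight≡expΛ∣ c1⊥c2 A⊆[1,n] uA≢0) ⟩
  ∏[1‥ M ] (expΛ∣ L)           ≡⟨ ∏-expΛ∣ L M L≤M ⟩
  L                            ∎
  where
  open LehmerSequence c1 c2
  open ≡-Reasoning
  L = lcmList (map (λ a → ∣ u a ∣) A)
  uA≢0 : All (λ a → NonZero ∣ u a ∣) A
  uA≢0 = All.map (λ (1≤a , _) → ≢-nonZero (u≢0 _ 1≤a ∘ ∣i∣≡0⇒i≡0)) A⊆[1,n]
  instance
    L≢0 : NonZero L
    L≢0 = lcmList≢0 (Allₚ.map⁺ uA≢0)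
    b≢0 : NonZero (gcd ∣ a1 * a1 ∣ ∣ a2 ∣)
    b≢0 = ≢-nonZero (gcd[m,n]≢0 _ _ (inj₁ ([ a1≢0 , a1≢0 ]′ ∘ i*j≡0⇒i≡0∨j≡0 a1 ∘ ∣i∣≡0⇒i≡0)))
  c1⊥c2 : Coprime ∣ c1 ∣ ∣ c2 ∣
  c1⊥c2 = coprime-cofactors (trans (sym (abs-* (bOf a1 a2) c1)) (cong ∣_∣ b*c1≡a1*a1))
                            (trans (sym (abs-* (bOf a1 a2) c2)) (trans (cong ∣_∣ b*c2≡-a2) (∣-i∣≡∣i∣ a2)))
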